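{- Let $m,n\ge 3$ be integers with $m$ odd and $n\equiv 2\pmod 4$, and suppose $m$ is a smallest odd integer $\ge3$ such that $G_{m,n'}$ has a $3$-dynamic $4$-coloring for some integer $n'\ge3$. Let $f$ be a $3$-dynamic $4$-coloring of $G_{m,n}$ and write $x_{i,j}=f(i,j)$. (1) Let $1\le r<m$ and $1\le s<t\le n$ with $s+2\le n$, and suppose row $r$ is periodic from column $s$ to column $t$. If $x_{r+1,s}=x_{r,s+1}$ and $x_{r+1,s+1}=x_{r,s+2}$, then $x_{r+1,j}=x_{r,j+1}$ for all $j$ with $s\le j<t$. Similarly, if $1\le c<n$, $1\le s<t\le m$ with $s+2\le m$, column $c$ is periodic from row $s$ to row $t$, $x_{s,c+1}=x_{s+1,c}$ and $x_{s+1,c+1}=x_{s+2,c}$, then $x_{j,c+1}=x_{j+1,c}$ for all $j$ with $s\le j<t$. (2) The hypotheses in (1) cannot hold when $x_{r+1,t-1}\ne x_{r,t}$ (in the row version), respectively when $x_{t-1,c+1}\ne x_{t,c}$ (in the column version). (3) The hypotheses in (1) cannot hold for row $r=2$ or column $c=2$: there is no $s$ with $1\le s\le n-2$ such that $x_{3,s}=x_{2,s+1}$ and $x_{3,s+1}=x_{2,s+2}$, and there is no $s$ with $1\le s\le m-2$ such that $x_{s,3}=x_{s+1,2}$ and $x_{s+1,3}=x_{s+2,2}$.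
   Context: For positive integers $m,n$, the grid $G_{m,n}$ is the graph with vertex set $[m]\times[n]$ (where $[p]=\{1,\dots,p\}$) in which $(i,j)$ and $(i',j')$ are adjacent iff $|i-i'|+|j-j'|=1$; vertex $(i,j)$ is in row $i$ and column $j$. An $r$-dynamic $k$-coloring of a graph $G$ is a proper vertex coloring $f$ with at most $k$ colors such that $|f(N(v))|\ge\min\{r,d(v)\}$ for every vertex $v$, where $N(v)$ is the neighborhood and $d(v)$ the degree of $v$. A portion of a row (resp. column) is periodic if any two positions in that portion having the same color are separated by a multiple of four positions, i.e., row $r$ is periodic from column $s$ to column $t$ if $x_{r,j}=x_{r,j'}$ with $s\le j,j'\le t$ implies $j\equiv j'\pmod 4$ (analogously for columns). -}

module Defs where

open import Data.Nat using (ℕ; zero; suc; _+_; _∸_; _≤_; _<_; _<?_; _≤?_; _%_; _⊓_; ∣_-_∣)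
open import Data.Nat.Properties using (_≟_)
open import Data.Fin as Fin using (Fin; toℕ; fromℕ<)
open import Data.Fin.Properties as FinP using ()
open import Data.List using (List; filter; length; cartesianProduct; allFin)
open import Data.List.Relation.Unary.Any using (any?)
open import Data.Product using (_×_; _,_; ∃-syntax; Σ-syntax)
open import Data.Maybe using (Maybe; just; nothing)
open import Relation.Nullary using (¬_; Dec; yes; no)
open import Relation.Binary.PropositionalEquality using (_≡_; _≢_)

-- Vertices of the grid G_{m,n}; (i , j) : Fin m × Fin n stands for the
-- vertex (toℕ i + 1 , toℕ j + 1) of [m] × [n].
Vertex : ℕ → ℕ → Set
Vertex m n = Fin m × Fin n

Adj : ∀ {m n} → Vertex m n → Vertex m n → Set
Adj (i , j) (i' , j') = ∣ toℕ i - toℕ i' ∣ + ∣ toℕ j - toℕ j' ∣ ≡ 1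

adj? : ∀ {m n} (u v : Vertex m n) → Dec (Adj u v)
adj? (i , j) (i' , j') = (∣ toℕ i - toℕ i' ∣ + ∣ toℕ j - toℕ j' ∣) ≟ 1

allVertices : (m n : ℕ) → List (Vertex m n)
allVertices m n = cartesianProduct (allFin m) (allFin n)

nbhd : ∀ {m n} → Vertex m n → List (Vertex m n)
nbhd {m} {n} v = filter (adj? v) (allVertices m n)

deg : ∀ {m n} → Vertex m n → ℕ
deg v = length (nbhd v)

nbhdColours : ∀ {m n k} → (Vertex m n → Fin k) → Vertex m n → ℕ
nbhdColours {k = k} f v =
  length (filter (λ c → any? (λ u → f u FinP.≟ c) (nbhd v)) (allFin k))

IsDynColouring : ∀ {m n k} → ℕ → (Vertex m n → Fin k) → Set
IsDynColouring r f =
  (∀ u v → Adj u v → f u ≢ f v) ×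
  (∀ v → r ⊓ deg v ≤ nbhdColours f v)

HasDynColouring : ℕ → ℕ → ℕ → ℕ → Set
HasDynColouring r k m n = Σ[ f ∈ (Vertex m n → Fin k) ] IsDynColouring r f

-- 1-based access x_{i,j} = f(i,j); `nothing` outside [m] × [n]
-- (all uses in the statement are within range).
entry : ∀ {m n k} → (Vertex m n → Fin k) → ℕ → ℕ → Maybe (Fin k)
entry {m} {n} f zero j = nothing
entry {m} {n} f (suc i) zero = nothing
entry {m} {n} f (suc i) (suc j) with i <? m | j <? n
... | yes p | yes q = just (f (fromℕ< p , fromℕ< q))
... | _ | _ = nothing

RowPeriodic : ∀ {m n k} → (Vertex m n → Fin k) → ℕ → ℕ → ℕ → Set
RowPeriodic f r s t = ∀ j j' → s ≤ j → j ≤ t → s ≤ j' → j' ≤ t →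
  entry f r j ≡ entry f r j' → j % 4 ≡ j' % 4

ColPeriodic : ∀ {m n k} → (Vertex m n → Fin k) → ℕ → ℕ → ℕ → Set
ColPeriodic f c s t = ∀ j j' → s ≤ j → j ≤ t → s ≤ j' → j' ≤ t →
  entry f j c ≡ entry f j' c → j % 4 ≡ j' % 4

Odd : ℕ → Set
Odd k = k % 2 ≡ 1

Good : ℕ → Set
Good m = ∃[ n' ] (3 ≤ n' × HasDynColouring 3 4 m n')

SmallestGoodOdd : ℕ → Set
SmallestGoodOdd m = Good m × (∀ m' → 3 ≤ m' → Odd m' → m' < m → ¬ Good m')

module Submission where

-- Write x(i,j) for the colour of cell (i,j), and say that row r+1 is shifted at column j when
-- x(r+1,j) = x(r,j+1). If row r+1 is shifted at j and j+1 and x(r,j+1), x(r,j+2), x(r,j+3) are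
-- distinct, it is shifted at j+2: the colour y of (r+1,j+2) is not x(r,j+1), since then
-- (r+1,j+1) would see a single colour on three sides, not x(r,j+2) by properness, and if y is
-- the fourth colour, the cell below (r+1,j+1) is forced to be x(r,j+3), after which (r+1,j+2)
-- only sees the two colours x(r,j+1) and x(r,j+2). Periodicity of row r supplies the
-- distinctness, which gives (1) and its instance (2). For (3), the cells of row 1 have at most
-- three neighbours, which forces any four consecutive colours of row 1 to be distinct and row 2
-- to repeat row 1 two columns further right; hence any three consecutive colours of row 2 are
-- distinct, and a shift below row 2 propagates until it reaches the last row or the last column,
-- where a cell with three neighbours sees only two colours. Columns are rows of the transposed grid.

open import Defs
open import Data.Empty using (⊥; ⊥-elim)
open import Data.Fin using (Fin; toℕ; fromℕ<)
import Data.Fin.Properties as Fin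
open import Data.Fin.Properties using (toℕ<n; fromℕ<-toℕ; toℕ-fromℕ<)
open import Data.List using (List; []; _∷_; _++_; length; allFin)
open import Data.List.Properties using (length-++)
open import Data.List.Membership.Propositional using (_∈_; find)
open import Data.List.Membership.Propositional.Properties
  using (∈-∃++; ∈-++⁻; ∈-++⁺ˡ; ∈-++⁺ʳ; ∈-allFin; ∈-filter⁺; ∈-filter⁻; ∈-cartesianProduct⁺)
open import Data.List.Membership.DecPropositional (Fin._≟_ {4}) using (_∈?_)
open import Data.List.Relation.Binary.Subset.Propositional using (_⊆_)
open import Data.List.Relation.Unary.All as All using ([]; _∷_)
open import Data.List.Relation.Unary.All.Properties using (¬Any⇒All¬)
open import Data.List.Relation.Unary.AllPairs using ([]; _∷_)
open import Data.List.Relation.Unary.Any using (Any; any?; here; there)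
open import Data.List.Relation.Unary.Unique.Propositional using (Unique)
open import Data.List.Relation.Unary.Unique.Propositional.Properties using (map⁻; filter⁺; allFin⁺)
open import Data.Maybe using (Maybe; just; nothing)
open import Data.Maybe.Properties using (just-injective)
import Data.Maybe.Relation.Unary.All as Maybe
open import Data.Nat
  using (ℕ; zero; suc; pred; _+_; _∸_; _≤_; _<_; _<?_; _%_; _⊓_; ∣_-_∣; z≤n; s≤s; z<s; NonZero; >-nonZero)
open import Data.Nat.Properties
  using ( <-irrefl; <⇒≤; ≤-refl; ≤-reflexive; ≤-trans; ≤-pred; ≤⇒≯; <⇒≤pred; m≤n⇒m<n∨m≡n
        ; m≤n+m; m+n≤o⇒n≤o; m∸n+n≡m; m≤o∸n⇒m+n≤o; m∸n≢0⇒n<m; suc-pred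
        ; +-comm; +-suc; +-cancelʳ-≡; ∣n-n∣≡0; ∣m-n∣≡0⇒m≡n; ⊓-monoʳ-≤; module ≤-Reasoning)
open import Data.Product using (_×_; _,_; proj₁; proj₂; ∃-syntax; uncurry)
import Data.Sum as Sum
open import Data.Sum using (_⊎_; inj₁; inj₂)
open import Function using (flip; _∘_)
open import Relation.Binary.PropositionalEquality
  using (_≡_; _≢_; ≢-sym; refl; sym; trans; cong; cong₂; subst; subst₂; module ≡-Reasoning)
open import Relation.Nullary using (¬_; yes; no; contradiction)
open import Relation.Unary using (Decidable)

unique-⊆⇒length≤ : ∀ {A : Set} {xs ys : List A} → Unique xs → xs ⊆ ys → length xs ≤ length ys
unique-⊆⇒length≤ {xs = []} _ _ = z≤n
unique-⊆⇒length≤ {xs = x ∷ xs} (x∉xs ∷ xs!) xs⊆ys with ∈-∃++ (xs⊆ys (here refl))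
... | ys₁ , ys₂ , refl = begin
  suc (length xs)              ≤⟨ s≤s (unique-⊆⇒length≤ xs! xs⊆ys₁++ys₂) ⟩
  suc (length (ys₁ ++ ys₂))    ≡⟨ cong suc (length-++ ys₁) ⟩
  suc (length ys₁ + length ys₂) ≡⟨ sym (+-suc (length ys₁) (length ys₂)) ⟩
  length ys₁ + length (x ∷ ys₂) ≡⟨ sym (length-++ ys₁) ⟩
  length (ys₁ ++ x ∷ ys₂)      ∎
  where
    open ≤-Reasoning
    xs⊆ys₁++ys₂ : xs ⊆ ys₁ ++ ys₂
    xs⊆ys₁++ys₂ y∈xs with ∈-++⁻ ys₁ (xs⊆ys (there y∈xs))
    ... | inj₁ y∈ys₁ = ∈-++⁺ˡ y∈ys₁
    ... | inj₂ (here refl) = contradiction refl (All.lookup x∉xs y∈xs)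
    ... | inj₂ (there y∈ys₂) = ∈-++⁺ʳ ys₁ y∈ys₂

four-distinct-colours-exhaust : ∀ {a b c d : Fin 4} → Unique (a ∷ b ∷ c ∷ d ∷ []) →
  ∀ z → z ∈ a ∷ b ∷ c ∷ d ∷ []
four-distinct-colours-exhaust {a} {b} {c} {d} abcd z with z ∈? (a ∷ b ∷ c ∷ d ∷ [])
... | yes z∈abcd = z∈abcd
... | no z∉abcd = contradiction
  (unique-⊆⇒length≤ (¬Any⇒All¬ _ z∉abcd ∷ abcd) (λ {w} _ → ∈-allFin w)) (<-irrefl refl)

middle-colours : ∀ {a b c d w : Fin 4} → Unique (a ∷ b ∷ c ∷ d ∷ []) →
  w ≢ a → w ≢ d → w ∈ b ∷ c ∷ []
middle-colours {w = w} abcd w≢a w≢d with four-distinct-colours-exhaust abcd w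
... | here w≡a = contradiction w≡a w≢a
... | there (here w≡b) = here w≡b
... | there (there (here w≡c)) = there (here w≡c)
... | there (there (there (here w≡d))) = contradiction w≡d w≢d

unique-just : ∀ {A : Set} {v₁ v₂ v₃ : Maybe A} {a b c} → Unique (v₁ ∷ v₂ ∷ v₃ ∷ []) →
  v₁ ≡ just a → v₂ ≡ just b → v₃ ≡ just c → Unique (a ∷ b ∷ c ∷ [])
unique-just distinct refl refl refl = map⁻ distinct

[1+n]%4≢n%4 : ∀ n → suc n % 4 ≢ n % 4
[1+n]%4≢n%4 0 ()
[1+n]%4≢n%4 1 ()
[1+n]%4≢n%4 2 ()
[1+n]%4≢n%4 3 ()
[1+n]%4≢n%4 (suc (suc (suc (suc n)))) = [1+n]%4≢n%4 n

[2+n]%4≢n%4 : ∀ n → suc (suc n) % 4 ≢ n % 4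
[2+n]%4≢n%4 0 ()
[2+n]%4≢n%4 1 ()
[2+n]%4≢n%4 2 ()
[2+n]%4≢n%4 3 ()
[2+n]%4≢n%4 (suc (suc (suc (suc n)))) = [2+n]%4≢n%4 n

-- RowPeriodic f r and ColPeriodic f c are Periodic (entry f r) and Periodic (λ i → entry f i c).
Periodic : ∀ {A : Set} → (ℕ → A) → ℕ → ℕ → Set
Periodic row s t =
  ∀ j j′ → s ≤ j → j ≤ t → s ≤ j′ → j′ ≤ t → row j ≡ row j′ → j % 4 ≡ j′ % 4

periodic⇒distinct₃ : ∀ {A : Set} {row : ℕ → A} {s t j} → Periodic row s t → s ≤ j → 2 + j ≤ t →
  Unique (row j ∷ row (1 + j) ∷ row (2 + j) ∷ [])
periodic⇒distinct₃ {row = row} {s} {t} {j} periodic s≤j j+2≤t =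
  (distinct (λ e → [1+n]%4≢n%4 j (sym e)) s≤j s≤j+1 j≤t j+1≤t
  ∷ distinct (λ e → [2+n]%4≢n%4 j (sym e)) s≤j s≤j+2 j≤t j+2≤t ∷ [])
  ∷ (distinct (λ e → [1+n]%4≢n%4 (1 + j) (sym e)) s≤j+1 s≤j+2 j+1≤t j+2≤t ∷ [])
  ∷ [] ∷ []
  where
    j+1≤t : 1 + j ≤ t
    j+1≤t = <⇒≤ j+2≤t
    j≤t : j ≤ t
    j≤t = <⇒≤ j+1≤t
    s≤j+1 : s ≤ 1 + j
    s≤j+1 = ≤-trans s≤j (m≤n+m j 1)
    s≤j+2 : s ≤ 2 + j
    s≤j+2 = ≤-trans s≤j (m≤n+m j 2)
    distinct : ∀ {k k′} → k % 4 ≢ k′ % 4 → s ≤ k → s ≤ k′ → k ≤ t → k′ ≤ t → row k ≢ row k′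
    distinct k≢k′ s≤k s≤k′ k≤t k′≤t e = k≢k′ (periodic _ _ s≤k k≤t s≤k′ k′≤t e)

Grid : Set
Grid = ℕ → ℕ → Maybe (Fin 4)

Defined : Maybe (Fin 4) → Set
Defined w = ∃[ c ] w ≡ just c

Among : List (Fin 4) → Maybe (Fin 4) → Set
Among cs = Maybe.All (_∈ cs)

among⇒∈ : ∀ {cs w c} → Among cs w → w ≡ just c → c ∈ cs
among⇒∈ (Maybe.just c∈cs) refl = c∈cs

-- The neighbours of cell (1 + i , 1 + j), in the order up, down, left, right.
AllAmong : List (Fin 4) → Grid → ℕ → ℕ → Set
AllAmong cs x i j =
  Among cs (x i (1 + j)) × Among cs (x (2 + i) (1 + j)) × Among cs (x (1 + i) j) × Among cs (x (1 + i) (2 + j))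

data ThreeDefined (x : Grid) (i j : ℕ) : Set where
  dlr : Defined (x (2 + i) (1 + j)) → Defined (x (1 + i) j) → Defined (x (1 + i) (2 + j)) → ThreeDefined x i j
  ulr : Defined (x i (1 + j)) → Defined (x (1 + i) j) → Defined (x (1 + i) (2 + j)) → ThreeDefined x i j
  udr : Defined (x i (1 + j)) → Defined (x (2 + i) (1 + j)) → Defined (x (1 + i) (2 + j)) → ThreeDefined x i j
  udl : Defined (x i (1 + j)) → Defined (x (2 + i) (1 + j)) → Defined (x (1 + i) j) → ThreeDefined x i j

-- The local consequences of x = entry f for a 3-dynamic colouring f of G_{M,N}; unlike
-- IsDynColouring they are visibly invariant under transposition.
record GridColouring (M N : ℕ) (x : Grid) : Set where
  field
    defined           : ∀ {i j} → 1 ≤ i → i ≤ M → 1 ≤ j → j ≤ N → Defined (x i j)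
    row₀-undefined    : ∀ j → x 0 j ≡ nothing
    column₀-undefined : ∀ i → x i 0 ≡ nothing
    below-undefined   : ∀ {i j} → M < i → x i j ≡ nothing
    right-undefined   : ∀ {i j} → N < j → x i j ≡ nothing
    proper-→          : ∀ {i j c} → x i j ≡ just c → x i (1 + j) ≢ just c
    proper-↓          : ∀ {i j c} → x i j ≡ just c → x (1 + i) j ≢ just c
    three-colours     : ∀ {i j c cs} → x (1 + i) (1 + j) ≡ just c → AllAmong cs x i j →
                        ThreeDefined x i j → 3 ≤ length cs
    two-colours       : ∀ {i j c cs} → x (1 + i) (1 + j) ≡ just c → AllAmong cs x i j →
                        Defined (x i (1 + j)) ⊎ Defined (x (2 + i) (1 + j)) →
                        Defined (x (1 + i) j) ⊎ Defined (x (1 + i) (2 + j)) → 2 ≤ length cs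

transpose : ∀ {M N x} → GridColouring M N x → GridColouring N M (flip x)
transpose {x = x} G = record
  { defined           = λ 1≤i i≤N 1≤j j≤M → defined 1≤j j≤M 1≤i i≤N
  ; row₀-undefined    = column₀-undefined
  ; column₀-undefined = row₀-undefined
  ; below-undefined   = right-undefined
  ; right-undefined   = below-undefined
  ; proper-→          = proper-↓
  ; proper-↓          = proper-→
  ; three-colours     = λ { x≡c (u , d , l , r) → three-colours x≡c (l , r , u , d) ∘ transpose-three }
  ; two-colours       = λ { x≡c (u , d , l , r) ud lr → two-colours x≡c (l , r , u , d) lr ud }
  }
  where
    open GridColouring G
    transpose-three : ∀ {i j} → ThreeDefined (flip x) i j → ThreeDefined x j i
    transpose-three (dlr d l r) = udr l r d
    transpose-three (ulr u l r) = udl l r u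
    transpose-three (udr u d r) = dlr r u d
    transpose-three (udl u d l) = ulr l u d

module GridColouringProperties {M N : ℕ} {x : Grid} (G : GridColouring M N x) where
  open GridColouring G

  Shifted : ℕ → ℕ → Set
  Shifted r j = x (1 + r) j ≡ x r (1 + j)

  among : ∀ {i j c cs} → x i j ≡ just c → c ∈ cs → Among cs (x i j)
  among x≡c c∈cs rewrite x≡c = Maybe.just c∈cs

  among-undefined : ∀ {i j cs} → x i j ≡ nothing → Among cs (x i j)
  among-undefined x≡nothing rewrite x≡nothing = Maybe.nothing

  among-own-colour : ∀ c (w : Maybe (Fin 4)) → ∃[ c′ ] Among (c ∷ c′ ∷ []) w
  among-own-colour c nothing = c , Maybe.nothing
  among-own-colour c (just c′) = c′ , Maybe.just (there (here refl))

  →-distinct : ∀ {i j a b} → x i j ≡ just a → x i (1 + j) ≡ just b → a ≢ b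
  →-distinct x≡a x≡b refl = proper-→ x≡a x≡b

  ↓-distinct : ∀ {i j a b} → x i j ≡ just a → x (1 + i) j ≡ just b → a ≢ b
  ↓-distinct x≡a x≡b refl = proper-↓ x≡a x≡b

  →-differ : ∀ {i j c} → x i j ≡ just c → x i j ≢ x i (1 + j)
  →-differ x≡c e = proper-→ x≡c (trans (sym e) x≡c)

  ↓-differ : ∀ {i j c} → x i j ≡ just c → x i j ≢ x (1 + i) j
  ↓-differ x≡c e = proper-↓ x≡c (trans (sym e) x≡c)

  three-neighbours-not-two-coloured : ∀ {i j c c₁ c₂} → x (1 + i) (1 + j) ≡ just c →
    AllAmong (c₁ ∷ c₂ ∷ []) x i j → ¬ ThreeDefined x i j
  three-neighbours-not-two-coloured x≡c among = <-irrefl refl ∘ three-colours x≡c among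

  -- Rows r and 1 + r, columns j to 3 + j:   .  a  b  c
  --                                         a  b  y  z
  no-fourth-colour-after-shift : ∀ {r j a b c y z} → Unique (y ∷ a ∷ b ∷ c ∷ []) →
    x r (1 + j) ≡ just a → x r (2 + j) ≡ just b → x r (3 + j) ≡ just c →
    x (1 + r) j ≡ just a → x (1 + r) (1 + j) ≡ just b →
    x (1 + r) (2 + j) ≡ just y → x (1 + r) (3 + j) ≡ just z → ⊥
  no-fourth-colour-after-shift {r} {j} {a} {b} {c} {y} yabc ra rb rc sa sb sy sz =
    three-neighbours-not-two-coloured sy
      (among rb (there (here refl)) , below-y , among sb (there (here refl)) ,
       among sz (middle-colours yabc (≢-sym (→-distinct sy sz)) (≢-sym (↓-distinct rc sz))))
      (ulr (_ , rb) (_ , sb) (_ , sz))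
    where
      b-sees-three-colours : ¬ Among (a ∷ y ∷ []) (x (2 + r) (1 + j))
      b-sees-three-colours below = three-neighbours-not-two-coloured sb
        (among ra (here refl) , below , among sa (here refl) , among sy (there (here refl)))
        (ulr (_ , ra) (_ , sa) (_ , sy))

      below-b-colour : ∀ {w} → x (2 + r) (1 + j) ≡ just w → w ≡ c
      below-b-colour {w} x≡w with four-distinct-colours-exhaust yabc w
      ... | here refl = ⊥-elim (b-sees-three-colours (among x≡w (there (here refl))))
      ... | there (here refl) = ⊥-elim (b-sees-three-colours (among x≡w (here refl)))
      ... | there (there (here refl)) = contradiction x≡w (proper-↓ sb)
      ... | there (there (there (here refl))) = refl

      below-b : x (2 + r) (1 + j) ≡ just c
      below-b with x (2 + r) (1 + j) in x≡
      ... | just w = cong just (below-b-colour x≡)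
      ... | nothing = ⊥-elim (b-sees-three-colours (among-undefined x≡))

      below-y : Among (a ∷ b ∷ []) (x (2 + r) (2 + j))
      below-y with x (2 + r) (2 + j) in x≡
      ... | nothing = Maybe.nothing
      ... | just w =
        Maybe.just (middle-colours yabc (≢-sym (↓-distinct sy x≡)) (≢-sym (→-distinct below-b x≡)))

  shift-continues : ∀ {r j a b c y z} → Unique (a ∷ b ∷ c ∷ []) →
    x r (1 + j) ≡ just a → x r (2 + j) ≡ just b → x r (3 + j) ≡ just c →
    x (1 + r) j ≡ just a → x (1 + r) (1 + j) ≡ just b →
    x (1 + r) (2 + j) ≡ just y → x (1 + r) (3 + j) ≡ just z → y ≡ c
  shift-continues {r} {j} {a} {b} {c} {y} abc ra rb rc sa sb sy sz with y ∈? a ∷ b ∷ c ∷ []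
  ... | yes (here refl) = ⊥-elim (three-neighbours-not-two-coloured sb
          (among ra (here refl) , proj₂ (among-own-colour a _) , among sa (here refl) , among sy (here refl))
          (ulr (_ , ra) (_ , sa) (_ , sy)))
  ... | yes (there (here refl)) = contradiction sy (proper-↓ rb)
  ... | yes (there (there (here refl))) = refl
  ... | no y∉abc = ⊥-elim (no-fourth-colour-after-shift (¬Any⇒All¬ _ y∉abc ∷ abc) ra rb rc sa sb sy sz)

  shift-step : ∀ {r q} → 1 ≤ r → r < M → 3 + q ≤ N →
    Unique (x r (1 + q) ∷ x r (2 + q) ∷ x r (3 + q) ∷ []) →
    Shifted r q → Shifted r (1 + q) → Shifted r (2 + q)
  shift-step {r} {q} 1≤r r<M q+3≤N distinct sh₀ sh₁
    with defined 1≤r (<⇒≤ r<M) z<s (m+n≤o⇒n≤o 2 q+3≤N)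
       | defined 1≤r (<⇒≤ r<M) z<s (m+n≤o⇒n≤o 1 q+3≤N)
       | defined 1≤r (<⇒≤ r<M) z<s q+3≤N
       | defined z<s r<M z<s (m+n≤o⇒n≤o 1 q+3≤N)
       | defined z<s r<M z<s q+3≤N
  ... | a , ra | b , rb | c , rc | y , sy | z , sz = begin
    x (1 + r) (2 + q)  ≡⟨ sy ⟩
    just y             ≡⟨ cong just (shift-continues abc ra rb rc (trans sh₀ ra) (trans sh₁ rb) sy sz) ⟩
    just c             ≡⟨ sym rc ⟩
    x r (3 + q)        ∎
    where
      open ≡-Reasoning
      abc : Unique (a ∷ b ∷ c ∷ [])
      abc = unique-just distinct ra rb rc

  shift-propagates : ∀ {r s t} → 1 ≤ r → r < M → t ≤ N →
    (∀ q → s ≤ q → 3 + q ≤ t → Unique (x r (1 + q) ∷ x r (2 + q) ∷ x r (3 + q) ∷ [])) →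
    Shifted r s → Shifted r (1 + s) → ∀ j → s ≤ j → j < t → Shifted r j
  shift-propagates {r} {s} {t} 1≤r r<M t≤N distinct sh₀ sh₁ j s≤j j<t =
    subst (Shifted r) (m∸n+n≡m s≤j) (shifted (j ∸ s) (subst (_< t) (sym (m∸n+n≡m s≤j)) j<t))
    where
      shifted : ∀ k → k + s < t → Shifted r (k + s)
      shifted 0 _ = sh₀
      shifted 1 _ = sh₁
      shifted (suc (suc k)) k+s+3≤t =
        shift-step 1≤r r<M (≤-trans k+s+3≤t t≤N) (distinct (k + s) (m≤n+m s k) k+s+3≤t)
          (shifted k (≤-trans (m≤n+m _ 2) k+s+3≤t)) (shifted (suc k) (≤-trans (m≤n+m _ 1) k+s+3≤t))

  top-neighbours-distinct : ∀ {j c l r d} → x 1 (1 + j) ≡ just c →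
    x 1 j ≡ just l → x 1 (2 + j) ≡ just r → x 2 (1 + j) ≡ just d → l ≢ r × l ≢ d × r ≢ d
  top-neighbours-distinct {j} {l = l} x≡c x≡l x≡r x≡d =
      (λ l≡r → two-coloured (among x≡d (there (here refl))) (among x≡r (here (sym l≡r))))
    , (λ l≡d → two-coloured (among x≡d (here (sym l≡d))) (among x≡r (there (here refl))))
    , (λ r≡d → two-coloured (among x≡d (there (here (sym r≡d)))) (among x≡r (there (here refl))))
    where
      two-coloured : ∀ {c₂} → Among (l ∷ c₂ ∷ []) (x 2 (1 + j)) →
                     Among (l ∷ c₂ ∷ []) (x 1 (2 + j)) → ⊥
      two-coloured down right = three-neighbours-not-two-coloured x≡c
        (among-undefined (row₀-undefined _) , down , among x≡l (here refl) , right)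
        (dlr (_ , x≡d) (_ , x≡l) (_ , x≡r))

  -- If d = a, then y₁ and y₂ below b and c both avoid a, b and c, hence are equal.
  row₁-distinct : ∀ {k a b c d} → 2 ≤ M → 1 ≤ k → 3 + k ≤ N →
    x 1 k ≡ just a → x 1 (1 + k) ≡ just b → x 1 (2 + k) ≡ just c → x 1 (3 + k) ≡ just d →
    Unique (a ∷ b ∷ c ∷ d ∷ [])
  row₁-distinct {k} {a} {b} {c} {d} 2≤M 1≤k k+3≤N xa xb xc xd
    with defined z<s 2≤M z<s (m+n≤o⇒n≤o 2 k+3≤N) | defined z<s 2≤M z<s (m+n≤o⇒n≤o 1 k+3≤N)
  ... | y₁ , xy₁ | y₂ , xy₂
    with top-neighbours-distinct xb xa xc xy₁ | top-neighbours-distinct xc xb xd xy₂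
  ... | a≢c , a≢y₁ , c≢y₁ | b≢d , b≢y₂ , d≢y₂ =
    (a≢b ∷ a≢c ∷ a≢d ∷ []) ∷ (b≢c ∷ b≢d ∷ []) ∷ (c≢d ∷ []) ∷ [] ∷ []
    where
      a≢b : a ≢ b
      a≢b = →-distinct xa xb
      b≢c : b ≢ c
      b≢c = →-distinct xb xc
      c≢d : c ≢ d
      c≢d = →-distinct xc xd
      y₁abc : Unique (y₁ ∷ a ∷ b ∷ c ∷ [])
      y₁abc = (≢-sym a≢y₁ ∷ ≢-sym (↓-distinct xb xy₁) ∷ ≢-sym c≢y₁ ∷ [])
            ∷ (a≢b ∷ a≢c ∷ []) ∷ (b≢c ∷ []) ∷ [] ∷ []
      a≢d : a ≢ d
      a≢d a≡d with four-distinct-colours-exhaust y₁abc y₂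
      ... | here y₂≡y₁ = →-distinct xy₁ xy₂ (sym y₂≡y₁)
      ... | there (here y₂≡a) = d≢y₂ (trans (sym a≡d) (sym y₂≡a))
      ... | there (there (here y₂≡b)) = b≢y₂ (sym y₂≡b)
      ... | there (there (there (here y₂≡c))) = ↓-distinct xc xy₂ (sym y₂≡c)

  row₂-repeats-row₁-inside : ∀ {k} → 2 ≤ M → 1 ≤ k → 3 + k ≤ N → x 2 (2 + k) ≡ x 1 k
  row₂-repeats-row₁-inside {k} 2≤M 1≤k k+3≤N
    with defined z<s (<⇒≤ 2≤M) 1≤k (m+n≤o⇒n≤o 3 k+3≤N)
       | defined z<s (<⇒≤ 2≤M) z<s (m+n≤o⇒n≤o 2 k+3≤N)
       | defined z<s (<⇒≤ 2≤M) z<s (m+n≤o⇒n≤o 1 k+3≤N)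
       | defined z<s (<⇒≤ 2≤M) z<s k+3≤N
       | defined z<s 2≤M z<s (m+n≤o⇒n≤o 1 k+3≤N)
  ... | a , xa | b , xb | c , xc | d , xd | y , xy
    with top-neighbours-distinct xc xb xd xy
       | four-distinct-colours-exhaust (row₁-distinct 2≤M 1≤k k+3≤N xa xb xc xd) y
  ... | _ | here refl = trans xy (sym xa)
  ... | _ , b≢y , _ | there (here refl) = contradiction refl b≢y
  ... | _ | there (there (here refl)) = contradiction xy (proper-↓ xc)
  ... | _ , _ , d≢y | there (there (there (here refl))) = contradiction refl d≢y

  -- The corner cell (1 , 3 + k) has only two neighbours, which must differ.
  row₂-repeats-row₁-at-end : ∀ {k} → 2 ≤ M → 1 ≤ k → 3 + k ≡ N → x 2 (3 + k) ≡ x 1 (1 + k)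
  row₂-repeats-row₁-at-end {k} 2≤M 1≤k k+3≡N
    with ≤-reflexive k+3≡N
  ... | k+3≤N
    with defined z<s (<⇒≤ 2≤M) 1≤k (m+n≤o⇒n≤o 3 k+3≤N)
       | defined z<s (<⇒≤ 2≤M) z<s (m+n≤o⇒n≤o 2 k+3≤N)
       | defined z<s (<⇒≤ 2≤M) z<s (m+n≤o⇒n≤o 1 k+3≤N)
       | defined z<s (<⇒≤ 2≤M) z<s k+3≤N
       | defined z<s 2≤M z<s k+3≤N
  ... | a , xa | b , xb | c , xc | d , xd | y , xy
    with four-distinct-colours-exhaust (row₁-distinct 2≤M 1≤k k+3≤N xa xb xc xd) y
  ... | here refl = contradiction xy (proper-→ (trans (row₂-repeats-row₁-inside 2≤M 1≤k k+3≤N) xa))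
  ... | there (here refl) = trans xy (sym xb)
  ... | there (there (here refl)) = ⊥-elim (<-irrefl refl
          (two-colours {cs = _ ∷ []} xd
            ( among-undefined (row₀-undefined _) , among xy (here refl) , among xc (here refl)
            , among-undefined (right-undefined (≤-reflexive (cong suc (sym k+3≡N)))))
            (inj₂ (_ , xy)) (inj₁ (_ , xc))))
  ... | there (there (there (here refl))) = contradiction xy (proper-↓ xd)

  row₂-repeats-row₁ : ∀ {k} → 2 ≤ M → 2 ≤ k → 2 + k ≤ N → x 2 (2 + k) ≡ x 1 k
  row₂-repeats-row₁ {suc k} 2≤M (s≤s 1≤k) k+2≤N with m≤n⇒m<n∨m≡n k+2≤N
  ... | inj₁ k+3≤N = row₂-repeats-row₁-inside 2≤M z<s k+3≤N
  ... | inj₂ k+3≡N = row₂-repeats-row₁-at-end 2≤M 1≤k k+3≡N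

  row₂-distinct₃ : ∀ {k} → 2 ≤ M → 2 ≤ k → 2 + k ≤ N →
    Unique (x 2 k ∷ x 2 (1 + k) ∷ x 2 (2 + k) ∷ [])
  row₂-distinct₃ {k} 2≤M 2≤k k+2≤N
    with defined z<s (<⇒≤ 2≤M) (<⇒≤ 2≤k) (m+n≤o⇒n≤o 2 k+2≤N)
       | defined z<s 2≤M (<⇒≤ 2≤k) (m+n≤o⇒n≤o 2 k+2≤N)
       | defined z<s 2≤M z<s (<⇒≤ k+2≤N)
  ... | a , xa | b , xb | c , xc =
    (→-differ xb ∷ (λ e → ↓-differ xa (sym (trans e (row₂-repeats-row₁ 2≤M 2≤k k+2≤N)))) ∷ [])
    ∷ (→-differ xc ∷ []) ∷ [] ∷ []

  no-shift-into-last-row : ∀ {r j} → 1 ≤ r → 1 + r ≡ M → 2 + j ≤ N → ¬ Shifted r j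
  no-shift-into-last-row {r} {j} 1≤r r+1≡M j+2≤N shift
    with defined z<s (≤-reflexive r+1≡M) z<s (<⇒≤ j+2≤N)
       | defined 1≤r (m+n≤o⇒n≤o 1 (≤-reflexive r+1≡M)) z<s (<⇒≤ j+2≤N)
       | defined z<s (≤-reflexive r+1≡M) z<s j+2≤N
  ... | c , xc | a , xa | e , xe = three-neighbours-not-two-coloured xc
    (among xa (here refl) , among-undefined (below-undefined (≤-reflexive (cong suc (sym r+1≡M)))) ,
     among (trans shift xa) (here refl) , among xe (there (here refl)))
    (ulr (_ , xa) (_ , trans shift xa) (_ , xe))

  no-shift-into-last-column : ∀ {r j} → 1 ≤ r → 2 + r ≤ M → 1 + j ≡ N → ¬ Shifted r j
  no-shift-into-last-column {r} {j} 1≤r r+2≤M j+1≡N shift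
    with defined z<s (<⇒≤ r+2≤M) z<s (≤-reflexive j+1≡N)
       | defined 1≤r (m+n≤o⇒n≤o 2 r+2≤M) z<s (≤-reflexive j+1≡N)
       | defined z<s r+2≤M z<s (≤-reflexive j+1≡N)
  ... | c , xc | a , xa | e , xe = three-neighbours-not-two-coloured xc
    (among xa (here refl) , among xe (there (here refl)) ,
     among (trans shift xa) (here refl) , among-undefined (right-undefined (≤-reflexive (cong suc (sym j+1≡N)))))
    (udl (_ , xa) (_ , xe) (_ , trans shift xa))

  no-shift-in-row₂ : ∀ {s} → 3 ≤ M → 1 ≤ s → 2 + s ≤ N → Shifted 2 s → ¬ Shifted 2 (1 + s)
  no-shift-in-row₂ {s} 3≤M 1≤s s+2≤N sh₀ sh₁ with m≤n⇒m<n∨m≡n 3≤M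
  ... | inj₂ 3≡M = no-shift-into-last-row z<s 3≡M s+2≤N sh₀
  ... | inj₁ 4≤M = no-shift-into-last-column z<s 4≤M (suc-pred N)
        (shift-propagates z<s 3≤M ≤-refl distinct sh₀ sh₁
          (pred N) (<⇒≤pred s<N) (≤-reflexive (suc-pred N)))
    where
      instance
        N≢0 : NonZero N
        N≢0 = >-nonZero (≤-trans z<s s+2≤N)
      s<N : s < N
      s<N = m+n≤o⇒n≤o 1 s+2≤N
      distinct : ∀ q → s ≤ q → 3 + q ≤ N → Unique (x 2 (1 + q) ∷ x 2 (2 + q) ∷ x 2 (3 + q) ∷ [])
      distinct q s≤q q+3≤N = row₂-distinct₃ (<⇒≤ 3≤M) (s≤s (≤-trans 1≤s s≤q)) q+3≤N

  periodic-shift-propagates : (r s t : ℕ) → 1 ≤ r → r < M → 1 ≤ s → s < t → t ≤ N → s + 2 ≤ N →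
    Periodic (x r) s t →
    x (r + 1) s ≡ x r (s + 1) → x (r + 1) (s + 1) ≡ x r (s + 2) →
    (j : ℕ) → s ≤ j → j < t → x (r + 1) j ≡ x r (j + 1)
  periodic-shift-propagates r s t 1≤r r<M _ _ t≤N _ periodic sh₀ sh₁ j s≤j j<t
    rewrite +-comm r 1 | +-comm s 1 | +-comm s 2 | +-comm j 1 =
    shift-propagates 1≤r r<M t≤N
      (λ q s≤q q+3≤t → periodic⇒distinct₃ periodic (≤-trans s≤q (m≤n+m q 1)) q+3≤t)
      sh₀ sh₁ j s≤j j<t

  periodic-shift-reaches-end : (r s t : ℕ) → 1 ≤ r → r < M → 1 ≤ s → s < t → t ≤ N → s + 2 ≤ N →
    Periodic (x r) s t →
    x (r + 1) s ≡ x r (s + 1) → x (r + 1) (s + 1) ≡ x r (s + 2) →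
    ¬ (x (r + 1) (t ∸ 1) ≢ x r t)
  periodic-shift-reaches-end r s (suc t) 1≤r r<M 1≤s s<t t≤N s+2≤N periodic sh₀ sh₁ differ =
    differ (subst (λ k → x (r + 1) t ≡ x r k) (+-comm t 1)
      (periodic-shift-propagates r s (suc t) 1≤r r<M 1≤s s<t t≤N s+2≤N periodic sh₀ sh₁
        t (≤-pred s<t) ≤-refl))

  no-shift-below-row₂ : 3 ≤ M → (s : ℕ) → 1 ≤ s → s ≤ N ∸ 2 →
    ¬ (x 3 s ≡ x 2 (s + 1) × x 3 (s + 1) ≡ x 2 (s + 2))
  no-shift-below-row₂ 3≤M s 1≤s s≤N∸2 (sh₀ , sh₁) rewrite +-comm s 1 | +-comm s 2 =
    no-shift-in-row₂ 3≤M 1≤s (subst (_≤ N) (+-comm s 2) (m≤o∸n⇒m+n≤o s 2≤N s≤N∸2)) sh₀ sh₁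
    where
      2≤N : 2 ≤ N
      2≤N = <⇒≤ (m∸n≢0⇒n<m λ N∸2≡0 →
        contradiction (≤-trans 1≤s (subst (s ≤_) N∸2≡0 s≤N∸2)) λ ())

data Direction : Set where
  up down left right : Direction

offset : Direction → ℕ × ℕ
offset up    = 0 , 1
offset down  = 2 , 1
offset left  = 1 , 0
offset right = 1 , 2

direction-of : ℕ × ℕ → Direction
direction-of (0 , _) = up
direction-of (1 , 0) = left
direction-of (1 , _) = right
direction-of _       = down

direction-of-offset : ∀ d → direction-of (offset d) ≡ d
direction-of-offset up    = refl
direction-of-offset down  = refl
direction-of-offset left  = refl
direction-of-offset right = refl

neighbour : Direction → ℕ → ℕ → ℕ × ℕ
neighbour d p q = proj₁ (offset d) + p , proj₂ (offset d) + q

neighbour-injective : ∀ {p q} d d′ → neighbour d p q ≡ neighbour d′ p q → d ≡ d′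
neighbour-injective {p} {q} d d′ e = begin
  d                         ≡⟨ sym (direction-of-offset d) ⟩
  direction-of (offset d)   ≡⟨ cong direction-of (cong₂ _,_ (+-cancelʳ-≡ p _ _ (cong proj₁ e))
                                                            (+-cancelʳ-≡ q _ _ (cong proj₂ e))) ⟩
  direction-of (offset d′)  ≡⟨ direction-of-offset d′ ⟩
  d′                        ∎
  where open ≡-Reasoning

-- Adj u v unfolds to Adjacent (pos u) (pos v), for the 1-based position pos u of u.
Adjacent : ℕ × ℕ → ℕ × ℕ → Set
Adjacent (a , b) (a′ , b′) = ∣ a - a′ ∣ + ∣ b - b′ ∣ ≡ 1

∣n-1+n∣≡1 : ∀ n → ∣ n - suc n ∣ ≡ 1
∣n-1+n∣≡1 zero    = refl
∣n-1+n∣≡1 (suc n) = ∣n-1+n∣≡1 n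

∣1+n-n∣≡1 : ∀ n → ∣ suc n - n ∣ ≡ 1
∣1+n-n∣≡1 zero    = refl
∣1+n-n∣≡1 (suc n) = ∣1+n-n∣≡1 n

∣m-n∣≡1⇒ : ∀ {m n} → ∣ m - n ∣ ≡ 1 → n ≡ suc m ⊎ m ≡ suc n
∣m-n∣≡1⇒ {zero}  {suc zero} _ = inj₁ refl
∣m-n∣≡1⇒ {suc zero} {zero}  _ = inj₂ refl
∣m-n∣≡1⇒ {suc m} {suc n} e = Sum.map (cong suc) (cong suc) (∣m-n∣≡1⇒ e)

m+n≡1⇒ : ∀ {m n} → m + n ≡ 1 → m ≡ 0 × n ≡ 1 ⊎ m ≡ 1 × n ≡ 0
m+n≡1⇒ {zero}        e = inj₁ (refl , e)
m+n≡1⇒ {suc zero} {zero} _ = inj₂ (refl , refl)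

neighbour-adjacent : ∀ d {p q} → Adjacent (suc p , suc q) (neighbour d p q)
neighbour-adjacent up    {p} {q} = cong₂ _+_ (∣1+n-n∣≡1 p) (∣n-n∣≡0 q)
neighbour-adjacent down  {p} {q} = cong₂ _+_ (∣n-1+n∣≡1 p) (∣n-n∣≡0 q)
neighbour-adjacent left  {p} {q} = cong₂ _+_ (∣n-n∣≡0 p) (∣1+n-n∣≡1 q)
neighbour-adjacent right {p} {q} = cong₂ _+_ (∣n-n∣≡0 p) (∣n-1+n∣≡1 q)

adjacent⇒neighbour : ∀ {p q} w → Adjacent (suc p , suc q) w → ∃[ d ] w ≡ neighbour d p q
adjacent⇒neighbour {p} {q} (a , b) e with m+n≡1⇒ {∣ suc p - a ∣} e
... | inj₁ (e₁ , e₂) with ∣m-n∣≡0⇒m≡n {suc p} {a} e₁ | ∣m-n∣≡1⇒ {suc q} {b} e₂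
...   | refl | inj₁ refl = right , refl
...   | refl | inj₂ refl = left , refl
adjacent⇒neighbour {p} {q} (a , b) e | inj₂ (e₁ , e₂)
  with ∣m-n∣≡1⇒ {suc p} {a} e₁ | ∣m-n∣≡0⇒m≡n {suc q} {b} e₂
...   | inj₁ refl | refl = down , refl
...   | inj₂ refl | refl = up , refl

module DynamicColouring {m n : ℕ} (f : Vertex m n → Fin 4) (dyn : IsDynColouring 3 f) where

  x : Grid
  x = entry f

  pos : Vertex m n → ℕ × ℕ
  pos (i , j) = suc (toℕ i) , suc (toℕ j)

  entry-in-range : ∀ {i j} (i<m : i < m) (j<n : j < n) →
    x (suc i) (suc j) ≡ just (f (fromℕ< i<m , fromℕ< j<n))
  entry-in-range {i} {j} i<m j<n with i <? m | j <? n
  ... | yes _    | yes _    = refl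
  ... | no  i≮m | _        = contradiction i<m i≮m
  ... | yes _    | no  j≮n = contradiction j<n j≮n

  entry-pos : ∀ u → uncurry x (pos u) ≡ just (f u)
  entry-pos (i , j) = trans (entry-in-range (toℕ<n i) (toℕ<n j))
    (cong (λ u → just (f u)) (cong₂ _,_ (fromℕ<-toℕ i _) (fromℕ<-toℕ j _)))

  entry≡just⇒vertex : ∀ {a b c} → x a b ≡ just c → ∃[ u ] pos u ≡ (a , b) × f u ≡ c
  entry≡just⇒vertex {suc a} {suc b} e with a <? m | b <? n
  ... | yes a<m | yes b<n =
      (fromℕ< a<m , fromℕ< b<n)
    , cong₂ _,_ (cong suc (toℕ-fromℕ< a<m)) (cong suc (toℕ-fromℕ< b<n))
    , just-injective e
  entry≡just⇒vertex {suc a} {suc b} () | no _  | _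
  entry≡just⇒vertex {suc a} {suc b} () | yes _ | no _

  colours-bound : ∀ v cs → (∀ u → Adj v u → f u ∈ cs) → nbhdColours f v ≤ length cs
  colours-bound v cs colour∈cs = unique-⊆⇒length≤ (filter⁺ seen? (allFin⁺ 4)) λ c∈ →
    let u , u∈N , fu≡c = find (proj₂ (∈-filter⁻ seen? {xs = allFin 4} c∈)) in
    subst (_∈ cs) fu≡c (colour∈cs u (proj₂ (∈-filter⁻ (adj? v) {xs = allVertices m n} u∈N)))
    where
      seen? : Decidable (λ c → Any (λ u → f u ≡ c) (nbhd v))
      seen? c = any? (λ u → f u Fin.≟ c) (nbhd v)

  degree-bound : ∀ v us → Unique us → (∀ {u} → u ∈ us → Adj v u) → length us ≤ deg v
  degree-bound v us us! adjacent = unique-⊆⇒length≤ us! λ {u} u∈us →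
    ∈-filter⁺ (adj? v) {xs = allVertices m n}
      (∈-cartesianProduct⁺ (∈-allFin (proj₁ u)) (∈-allFin (proj₂ u))) (adjacent u∈us)

  dynamic-bound : ∀ v us cs → Unique us → (∀ {u} → u ∈ us → Adj v u) →
    (∀ u → Adj v u → f u ∈ cs) → 3 ⊓ length us ≤ length cs
  dynamic-bound v us cs us! adjacent colour∈cs =
    ≤-trans (⊓-monoʳ-≤ 3 (degree-bound v us us! adjacent))
            (≤-trans (proj₂ dyn v) (colours-bound v cs colour∈cs))

  entry-at : ∀ {u w} → pos u ≡ w → uncurry x w ≡ just (f u)
  entry-at {u} refl = entry-pos u

  vertex-at : ∀ {w} → Defined (uncurry x w) → ∃[ u ] pos u ≡ w
  vertex-at (_ , e) with entry≡just⇒vertex e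
  ... | u , pos-u , _ = u , pos-u

  module Centre {p q} (v : Vertex m n) (pos-v : pos v ≡ (suc p , suc q)) where

    adjacent-at : ∀ d {u} → pos u ≡ neighbour d p q → Adj v u
    adjacent-at d pos-u = subst₂ Adjacent (sym pos-v) (sym pos-u) (neighbour-adjacent d)

    distinct-at : ∀ {d d′ u u′} → d ≢ d′ →
      pos u ≡ neighbour d p q → pos u′ ≡ neighbour d′ p q → u ≢ u′
    distinct-at d≢d′ pos-u pos-u′ refl = d≢d′ (neighbour-injective _ _ (trans (sym pos-u) pos-u′))

    colours-among : ∀ {cs} → AllAmong cs x p q → ∀ u → Adj v u → f u ∈ cs
    colours-among (above , below , left′ , right′) u adj
      with adjacent⇒neighbour (pos u) (subst (λ w → Adjacent w (pos u)) pos-v adj)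
    ... | up    , pos-u = among⇒∈ above  (entry-at pos-u)
    ... | down  , pos-u = among⇒∈ below  (entry-at pos-u)
    ... | left  , pos-u = among⇒∈ left′  (entry-at pos-u)
    ... | right , pos-u = among⇒∈ right′ (entry-at pos-u)

    three-neighbours : ∀ {cs} d₁ d₂ d₃ → AllAmong cs x p q → d₁ ≢ d₂ → d₁ ≢ d₃ → d₂ ≢ d₃ →
      Defined (uncurry x (neighbour d₁ p q)) → Defined (uncurry x (neighbour d₂ p q)) →
      Defined (uncurry x (neighbour d₃ p q)) → 3 ≤ length cs
    three-neighbours d₁ d₂ d₃ among d₁≢d₂ d₁≢d₃ d₂≢d₃ def₁ def₂ def₃
      with vertex-at def₁ | vertex-at def₂ | vertex-at def₃
    ... | u₁ , pos-u₁ | u₂ , pos-u₂ | u₃ , pos-u₃ = dynamic-bound v (u₁ ∷ u₂ ∷ u₃ ∷ []) _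
      ((distinct-at d₁≢d₂ pos-u₁ pos-u₂ ∷ distinct-at d₁≢d₃ pos-u₁ pos-u₃ ∷ []) ∷
       (distinct-at d₂≢d₃ pos-u₂ pos-u₃ ∷ []) ∷ [] ∷ [])
      (λ { (here refl) → adjacent-at d₁ pos-u₁
         ; (there (here refl)) → adjacent-at d₂ pos-u₂
         ; (there (there (here refl))) → adjacent-at d₃ pos-u₃ })
      (colours-among among)

    two-neighbours : ∀ {cs} d₁ d₂ → AllAmong cs x p q → d₁ ≢ d₂ →
      Defined (uncurry x (neighbour d₁ p q)) → Defined (uncurry x (neighbour d₂ p q)) → 2 ≤ length cs
    two-neighbours d₁ d₂ among d₁≢d₂ def₁ def₂ with vertex-at def₁ | vertex-at def₂
    ... | u₁ , pos-u₁ | u₂ , pos-u₂ = dynamic-bound v (u₁ ∷ u₂ ∷ []) _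
      ((distinct-at d₁≢d₂ pos-u₁ pos-u₂ ∷ []) ∷ [] ∷ [])
      (λ { (here refl) → adjacent-at d₁ pos-u₁ ; (there (here refl)) → adjacent-at d₂ pos-u₂ })
      (colours-among among)

  three-colours : ∀ {p q c cs} → x (suc p) (suc q) ≡ just c → AllAmong cs x p q →
    ThreeDefined x p q → 3 ≤ length cs
  three-colours {p} {q} {cs = cs} x≡c among three with entry≡just⇒vertex x≡c
  ... | v , pos-v , _ = from-three three
    where
      open Centre v pos-v
      from-three : ThreeDefined x p q → 3 ≤ length cs
      from-three (dlr d l r) = three-neighbours down left right among (λ ()) (λ ()) (λ ()) d l r
      from-three (ulr u l r) = three-neighbours up left right among (λ ()) (λ ()) (λ ()) u l r
      from-three (udr u d r) = three-neighbours up down right among (λ ()) (λ ()) (λ ()) u d r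
      from-three (udl u d l) = three-neighbours up down left among (λ ()) (λ ()) (λ ()) u d l

  two-colours : ∀ {p q c cs} → x (suc p) (suc q) ≡ just c → AllAmong cs x p q →
    Defined (x p (suc q)) ⊎ Defined (x (2 + p) (suc q)) →
    Defined (x (suc p) q) ⊎ Defined (x (suc p) (2 + q)) → 2 ≤ length cs
  two-colours {p} {q} {cs = cs} x≡c among vertical horizontal with entry≡just⇒vertex x≡c
  ... | v , pos-v , _ = from-two vertical horizontal
    where
      open Centre v pos-v
      from-two : Defined (x p (suc q)) ⊎ Defined (x (2 + p) (suc q)) →
                 Defined (x (suc p) q) ⊎ Defined (x (suc p) (2 + q)) → 2 ≤ length cs
      from-two (inj₁ u) (inj₁ l) = two-neighbours up left among (λ ()) u l
      from-two (inj₁ u) (inj₂ r) = two-neighbours up right among (λ ()) u r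
      from-two (inj₂ d) (inj₁ l) = two-neighbours down left among (λ ()) d l
      from-two (inj₂ d) (inj₂ r) = two-neighbours down right among (λ ()) d r

  proper : ∀ {a b a′ b′ c} → Adjacent (a , b) (a′ , b′) → x a b ≡ just c → x a′ b′ ≢ just c
  proper {a} {b} {a′} {b′} adjacent x≡c x′≡c
    with entry≡just⇒vertex {a} {b} x≡c | entry≡just⇒vertex {a′} {b′} x′≡c
  ... | u , refl , fu≡c | u′ , refl , fu′≡c = proj₁ dyn u u′ adjacent (trans fu≡c (sym fu′≡c))

  off-grid : ∀ {a b} → (∀ u → pos u ≢ (a , b)) → x a b ≡ nothing
  off-grid {a} {b} not-a-vertex with x a b in x≡
  ... | nothing = refl
  ... | just _  = contradiction (proj₁ (proj₂ (entry≡just⇒vertex x≡))) (not-a-vertex _)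

  proper-→ : ∀ {a b c} → x a b ≡ just c → x a (suc b) ≢ just c
  proper-→ {a} {b} = proper {a} {b} {a} {suc b} (cong₂ _+_ (∣n-n∣≡0 a) (∣n-1+n∣≡1 b))

  proper-↓ : ∀ {a b c} → x a b ≡ just c → x (suc a) b ≢ just c
  proper-↓ {a} {b} = proper {a} {b} {suc a} {b} (cong₂ _+_ (∣n-1+n∣≡1 a) (∣n-n∣≡0 b))

  below-undefined : ∀ {a b} → m < a → x a b ≡ nothing
  below-undefined {a} {b} m<a = off-grid {a} {b} λ u pos-u →
    ≤⇒≯ (subst (_≤ m) (cong proj₁ pos-u) (toℕ<n (proj₁ u))) m<a

  right-undefined : ∀ {a b} → n < b → x a b ≡ nothing
  right-undefined {a} {b} n<b = off-grid {a} {b} λ u pos-u →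
    ≤⇒≯ (subst (_≤ n) (cong proj₂ pos-u) (toℕ<n (proj₂ u))) n<b

  grid-colouring : GridColouring m n x
  grid-colouring = record
    { defined           = λ { {suc i} {suc j} _ i<m _ j<n → _ , entry-in-range i<m j<n }
    ; row₀-undefined    = λ _ → refl
    ; column₀-undefined = λ { zero → refl ; (suc _) → refl }
    ; below-undefined   = λ {i} {j} → below-undefined {i} {j}
    ; right-undefined   = λ {i} {j} → right-undefined {i} {j}
    ; proper-→          = λ {i} {j} → proper-→ {i} {j}
    ; proper-↓          = λ {i} {j} → proper-↓ {i} {j}
    ; three-colours     = three-colours
    ; two-colours       = two-colours
    }

open GridColouringProperties using (periodic-shift-propagates; periodic-shift-reaches-end; no-shift-below-row₂)

lemma2p5 : (m n : ℕ) → 3 ≤ m → 3 ≤ n → Odd m → n % 4 ≡ 2 → SmallestGoodOdd m →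
  (f : Vertex m n → Fin 4) → IsDynColouring 3 f →
  -- (1) row version
  ((r s t : ℕ) → 1 ≤ r → r < m → 1 ≤ s → s < t → t ≤ n → s + 2 ≤ n →
    RowPeriodic f r s t →
    entry f (r + 1) s ≡ entry f r (s + 1) →
    entry f (r + 1) (s + 1) ≡ entry f r (s + 2) →
    (j : ℕ) → s ≤ j → j < t → entry f (r + 1) j ≡ entry f r (j + 1))
  ×
  -- (1) column version
  ((c s t : ℕ) → 1 ≤ c → c < n → 1 ≤ s → s < t → t ≤ m → s + 2 ≤ m →
    ColPeriodic f c s t →
    entry f s (c + 1) ≡ entry f (s + 1) c →
    entry f (s + 1) (c + 1) ≡ entry f (s + 2) c →
    (j : ℕ) → s ≤ j → j < t → entry f j (c + 1) ≡ entry f (j + 1) c)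
  ×
  -- (2) row version
  ((r s t : ℕ) → 1 ≤ r → r < m → 1 ≤ s → s < t → t ≤ n → s + 2 ≤ n →
    RowPeriodic f r s t →
    entry f (r + 1) s ≡ entry f r (s + 1) →
    entry f (r + 1) (s + 1) ≡ entry f r (s + 2) →
    ¬ (entry f (r + 1) (t ∸ 1) ≢ entry f r t))
  ×
  -- (2) column version
  ((c s t : ℕ) → 1 ≤ c → c < n → 1 ≤ s → s < t → t ≤ m → s + 2 ≤ m →
    ColPeriodic f c s t →
    entry f s (c + 1) ≡ entry f (s + 1) c →
    entry f (s + 1) (c + 1) ≡ entry f (s + 2) c →
    ¬ (entry f (t ∸ 1) (c + 1) ≢ entry f t c))
  ×
  -- (3) row r = 2
  ((s : ℕ) → 1 ≤ s → s ≤ n ∸ 2 →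
    ¬ (entry f 3 s ≡ entry f 2 (s + 1) × entry f 3 (s + 1) ≡ entry f 2 (s + 2)))
  ×
  -- (3) column c = 2
  ((s : ℕ) → 1 ≤ s → s ≤ m ∸ 2 →
    ¬ (entry f s 3 ≡ entry f (s + 1) 2 × entry f (s + 1) 3 ≡ entry f (s + 2) 2))
lemma2p5 m n 3≤m 3≤n _ _ _ f dyn =
    periodic-shift-propagates G , periodic-shift-propagates Gᵀ
  , periodic-shift-reaches-end G , periodic-shift-reaches-end Gᵀ
  , no-shift-below-row₂ G 3≤m , no-shift-below-row₂ Gᵀ 3≤n
  where
    G : GridColouring m n (entry f)
    G = DynamicColouring.grid-colouring f dyn
    Gᵀ : GridColouring n m (flip (entry f))
    Gᵀ = transpose G
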